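{- Let $s\ge 1$ and $t\ge 1$ be integers. Then $\chi_p(P_{4t}\Diamond_4 C_{4s+1})\le 5$.
   Context: A packing $k$-coloring of a graph $H$ is a map $c:V(H)\to\{1,\ldots,k\}$ such that any two distinct vertices $u,v$ with $c(u)=c(v)=i$ satisfy $d_H(u,v)\ge i+1$. The packing chromatic number $\chi_p(H)$ is the least such $k$. $P_m$ denotes the path $v_1\cdots v_m$ and $C_n$ the cycle on $n$ vertices. Path-aligned product: for positive integers $\ell\mid m$ and a connected vertex-transitive graph $G$ containing $P_\ell$ as a subgraph, $P_m\Diamond_\ell G$ is formed from the path $P_m=v_1\cdots v_m$ and $m/\ell$ pairwise disjoint copies of $G$, where for each $1\le i\le m/\ell$ the consecutive path vertices $v_{(i-1)\ell+1},\ldots,v_{i\ell}$ are identified, in order, with the vertices of a path $P_\ell$ (i.e. $\ell$ consecutive cycle vertices when $G$ is a cycle) in the $i$-th copy of $G$. -}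

module Defs where

open import Level using (0ℓ)
open import Data.Nat using (ℕ; zero; suc; _+_; _*_; _≤_; _/_; _%_; NonZero)
open import Data.Nat.DivMod using (_mod_)
open import Data.Fin using (Fin; toℕ; fromℕ)
open import Data.Product using (_×_; _,_; ∃-syntax; Σ-syntax)
open import Data.Sum using (_⊎_)
open import Relation.Binary.PropositionalEquality using (_≡_; _≢_)

record Graph : Set₁ where
  field
    V   : Set
    Adj : V → V → Set
open Graph public

data Walk (H : Graph) : V H → V H → ℕ → Set where
  here : ∀ {u} → Walk H u u 0
  step : ∀ {u w v n} → Adj H u w → Walk H w v n → Walk H u v (suc n)

-- d_H(u,v) ≥ d : every walk from u to v has length at least d
-- (equivalently the shortest u–v path has length ≥ d; ∞ if disconnected).
DistGe : (H : Graph) → V H → V H → ℕ → Set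
DistGe H u v d = ∀ n → Walk H u v n → d ≤ n

IsPackingColoring : (H : Graph) (k : ℕ) → (V H → ℕ) → Set
IsPackingColoring H k c =
  (∀ u → 1 ≤ c u × c u ≤ k) ×
  (∀ u v → u ≢ v → c u ≡ c v → DistGe H u v (suc (c u)))

PackingChromaticNumber≤ : Graph → ℕ → Set
PackingChromaticNumber≤ H k =
  ∃[ k' ] (k' ≤ k × ∃[ c ] IsPackingColoring H k' c)

Cycle : (n : ℕ) → .{{NonZero n}} → Graph
Cycle n = record
  { V   = Fin n
  ; Adj = λ a b → (toℕ b ≡ suc (toℕ a) % n) ⊎ (toℕ a ≡ suc (toℕ b) % n)
  }

-- Path-aligned product P_m ◇_ℓ G, written  PathAligned m (ℓ-1) G p  (so ℓ ≥ 1 is built in).  The path P_ℓ in G is given by the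
-- vertex map p : Fin ℓ → V G (p 0, …, p (ℓ-1) consecutive along the path).  Path vertex
-- v_{iℓ+j+1} is identified with (i , p j).  Edges: the edges of each copy
-- of G (which contain the path edges inside a block), plus the path edge
-- v_{(i+1)ℓ} v_{(i+1)ℓ+1}, i.e. (i , p (ℓ-1)) ~ (i+1 , p 0).
PathAligned : (m ℓ : ℕ) (G : Graph) (p : Fin (suc ℓ) → V G) → Graph
PathAligned m ℓ G p = record
  { V   = Fin (m / suc ℓ) × V G
  ; Adj = λ { (i , x) (j , y) →
        (i ≡ j × Adj G x y)
      ⊎ (toℕ j ≡ suc (toℕ i) × x ≡ p (fromℕ ℓ) × y ≡ p Fin.zero)
      ⊎ (toℕ i ≡ suc (toℕ j) × y ≡ p (fromℕ ℓ) × x ≡ p Fin.zero) }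
  }
  where import Data.Fin as Fin

P◇C : (t s : ℕ) → Graph
P◇C t s = PathAligned (4 * t) 3 (Cycle (suc (4 * s))) (λ j → toℕ j mod suc (4 * s))

{-# OPTIONS --safe #-}
-- A walk from copy i to a later copy j of C_n must cross every bridge between them and run
-- through each intermediate copy from 0 to ℓ, which gives explicit lower bounds on distances;
-- they are proved by exhibiting them as a 1-Lipschitz potential vanishing at the start vertex.
-- For s ≥ 2 every copy of C_{4s+1} is coloured 1 3 1 2 1 3 1 2 … 1 3 1 2 4: equal colours are far
-- apart on the cycle, and far enough from the path ends 0 and 3 to be far apart across copies.
-- For s = 1 the two vertices coloured 4 in consecutive copies would be only 3 apart, so instead
-- the copies of C_5 are coloured alternately 1 2 3 1 4 and 2 1 3 5 1, checked by computation.
module Submission where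

open import Defs
open import Data.Empty using (⊥-elim)
open import Data.Fin using (Fin; toℕ; fromℕ) renaming (zero to fzero; suc to fsuc)
open import Data.Fin.Properties
  using (toℕ-injective; toℕ<n; toℕ-fromℕ; toℕ-fromℕ<; all?) renaming (_≟_ to _≟ᶠ_)
open import Data.Nat hiding (parity)
open import Data.Nat.DivMod using (_%_; _mod_; m<n⇒m%n≡m; n%n≡0)
open import Data.Nat.Properties
open import Data.Product using (_×_; _,_; proj₁; proj₂)
open import Data.Sum using (_⊎_; inj₁; inj₂)
open import Data.Vec using (Vec; []; _∷_; lookup)
open import Function using (_∘_)
open import Relation.Binary using (Symmetric; tri<; tri≈; tri>)
open import Relation.Binary.PropositionalEquality
open import Relation.Nullary using (yes; no; ¬?)
open import Relation.Nullary.Decidable using (from-yes; _×-dec_; _→-dec_)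

module _ (H : Graph) where

  Lipschitz : (V H → ℕ) → Set
  Lipschitz f = ∀ {x y} → Adj H x y → f y ≤ suc (f x)

  lipschitz-walk : ∀ {f} → Lipschitz f → ∀ {u v k} → Walk H u v k → f v ≤ k + f u
  lipschitz-walk lip here = ≤-refl
  lipschitz-walk {f} lip (step {u} {n = k} e w) = begin
    f _           ≤⟨ lipschitz-walk lip w ⟩
    k + f _       ≤⟨ +-monoʳ-≤ k (lip e) ⟩
    k + suc (f u) ≡⟨ +-suc k (f u) ⟩
    suc k + f u   ∎
    where open ≤-Reasoning

  lipschitz⇒DistGe : ∀ {f u} → Lipschitz f → f u ≡ 0 → ∀ v → DistGe H u v (f v)
  lipschitz⇒DistGe {f} lip fu≡0 v k w =
    subst (f v ≤_) (trans (cong (k +_) fu≡0) (+-identityʳ k)) (lipschitz-walk lip w)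

module _ {H : Graph} (adj-sym : Symmetric (Adj H)) where

  walk-snoc : ∀ {u w v k} → Walk H u w k → Adj H w v → Walk H u v (suc k)
  walk-snoc here       e = step e here
  walk-snoc (step f w) e = step f (walk-snoc w e)

  walk-reverse : ∀ {u v k} → Walk H u v k → Walk H v u k
  walk-reverse here       = here
  walk-reverse (step e w) = walk-snoc (walk-reverse w) (adj-sym e)

  DistGe-sym : ∀ {u v d} → DistGe H u v d → DistGe H v u d
  DistGe-sym D k w = D k (walk-reverse w)

Near : ℕ → ℕ → Set
Near a b = a ≤ suc b × b ≤ suc a

near-refl : ∀ a → Near a a
near-refl a = n≤1+n a , n≤1+n a

near-sym : ∀ {a b} → Near a b → Near b a
near-sym (p , q) = q , p

near-suc : ∀ a → Near a (suc a)
near-suc a = m≤n⇒m≤1+n (n≤1+n a) , ≤-refl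

near-+ˡ : ∀ k {a b} → Near a b → Near (k + a) (k + b)
near-+ˡ k {a} {b} (p , q) =
  ≤-trans (+-monoʳ-≤ k p) (≤-reflexive (+-suc k b)) ,
  ≤-trans (+-monoʳ-≤ k q) (≤-reflexive (+-suc k a))

near-+ʳ : ∀ k {a b} → Near a b → Near (a + k) (b + k)
near-+ʳ k {a} {b} h = subst₂ Near (+-comm k a) (+-comm k b) (near-+ˡ k h)

near-⊓ : ∀ {a b c d} → Near a b → Near c d → Near (a ⊓ c) (b ⊓ d)
near-⊓ (p , q) (r , s) = ⊓-mono-≤ p r , ⊓-mono-≤ q s

near-∸ : ∀ n {a b} → Near a b → Near (n ∸ a) (n ∸ b)
near-∸ n {a} {b} (p , q) = bound q , bound p
  where
  bound : ∀ {a b} → b ≤ suc a → n ∸ a ≤ suc (n ∸ b)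
  bound {a} {b} b≤1+a = m≤n+o⇒m∸n≤o n a (begin
    n                 ≤⟨ m≤n+m∸n n b ⟩
    b + (n ∸ b)       ≤⟨ +-monoˡ-≤ (n ∸ b) b≤1+a ⟩
    suc a + (n ∸ b)   ≡⟨ +-suc a (n ∸ b) ⟨
    a + suc (n ∸ b)   ∎)
    where open ≤-Reasoning

near-∣-∣-suc : ∀ a x → Near ∣ a - x ∣ ∣ a - suc x ∣
near-∣-∣-suc zero          x       = near-suc x
near-∣-∣-suc (suc zero)    zero    = near-sym (near-suc 0)
near-∣-∣-suc (suc (suc a)) zero    = near-sym (near-suc (suc a))
near-∣-∣-suc (suc a)       (suc x) = near-∣-∣-suc a x

cycleDist : ℕ → ℕ → ℕ → ℕ
cycleDist n x y = ∣ x - y ∣ ⊓ (n ∸ ∣ x - y ∣)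

cycleDist-comm : ∀ n x y → cycleDist n x y ≡ cycleDist n y x
cycleDist-comm n x y rewrite ∣-∣-comm x y = refl

cycleDist-self : ∀ n x → cycleDist n x x ≡ 0
cycleDist-self n x rewrite ∣n-n∣≡0 x = refl

cycleDist-≥ : ∀ n {x y k} → k + x ≤ y → k + y ≤ x + n → k ≤ cycleDist n x y
cycleDist-≥ n {x} {y} {k} k+x≤y k+y≤x+n =
  subst (λ d → k ≤ d ⊓ (n ∸ d)) (sym (m≤n⇒∣m-n∣≡n∸m x≤y))
    (⊓-glb (m+n≤o⇒m≤o∸n k k+x≤y) (m+n≤o⇒m≤o∸n k k+[y∸x]≤n))
  where
  x≤y : x ≤ y
  x≤y = ≤-trans (m≤n+m x k) k+x≤y
  k+[y∸x]≤n : k + (y ∸ x) ≤ n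
  k+[y∸x]≤n = subst (_≤ n) (+-∸-assoc k x≤y) (m≤n+o⇒m∸n≤o (k + y) x k+y≤x+n)

cycleDist-pos : ∀ {n x y} → x ≢ y → x < n → y < n → 1 ≤ cycleDist n x y
cycleDist-pos {n} {x} {y} x≢y x<n y<n with <-cmp x y
... | tri< x<y _ _ = cycleDist-≥ n x<y (≤-trans y<n (m≤n+m n x))
... | tri≈ _ x≡y _ = ⊥-elim (x≢y x≡y)
... | tri> _ _ y<x =
  subst (1 ≤_) (cycleDist-comm n y x) (cycleDist-≥ n y<x (≤-trans x<n (m≤n+m n y)))

cycleDist-wrap : ∀ {x a} → a ≤ x → Near (cycleDist (suc x) a x) (cycleDist (suc x) 0 a)
-- Here cycleDist (1 + x) a x = (x ∸ a) ⊓ (1 + a) and cycleDist (1 + x) 0 a = a ⊓ (1 + (x ∸ a)).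
cycleDist-wrap {x} {a} a≤x
  rewrite m≤n⇒∣m-n∣≡n∸m a≤x
        | +-∸-assoc 1 (m∸n≤m x a)
        | m∸[m∸n]≡n a≤x
        | +-∸-assoc 1 a≤x
        | ⊓-comm a (suc (x ∸ a))
  = near-⊓ (near-suc (x ∸ a)) (near-sym (near-suc a))

cycleDist-step : ∀ {n} .{{_ : NonZero n}} {a x} → a < n → x < n →
                 Near (cycleDist n a x) (cycleDist n a (suc x % n))
cycleDist-step {n} {a = a} {x} a<n x<n with m≤n⇒m<n∨m≡n x<n
... | inj₁ 1+x<n rewrite m<n⇒m%n≡m 1+x<n =
  near-⊓ (near-∣-∣-suc a x) (near-∸ n (near-∣-∣-suc a x))
... | inj₂ refl =
  subst (Near _) (trans (cycleDist-comm (suc x) 0 a) (cong (cycleDist (suc x) a) (sym (n%n≡0 (suc x)))))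
    (cycleDist-wrap (≤-pred a<n))

module _ (n ℓ : ℕ) where

  -- A walk from copy i to copy i + 1 + k leaves copy i through ℓ, crosses k + 1 bridges,
  -- runs from 0 to ℓ through each of the k copies in between, and enters copy i + 1 + k at 0.
  copyDistBound : ℕ → ℕ → ℕ → ℕ
  copyDistBound zero    a b = cycleDist n a b
  copyDistBound (suc k) a b = suc (cycleDist n a ℓ + cycleDist n 0 b + k * suc (cycleDist n 0 ℓ))

  copyDistBound-mono : ∀ {j k} a b → j ≤ k → copyDistBound (suc j) a b ≤ copyDistBound (suc k) a b
  copyDistBound-mono a b j≤k =
    s≤s (+-monoʳ-≤ (cycleDist n a ℓ + cycleDist n 0 b) (*-monoˡ-≤ (suc (cycleDist n 0 ℓ)) j≤k))

  -- A 1-Lipschitz function of the vertex (j , y) vanishing at (i , a).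
  potential : ℕ → ℕ → ℕ → ℕ → ℕ
  potential zero    a j       y = copyDistBound j a y
  potential (suc i) a zero    y = suc (cycleDist n a 0)
  potential (suc i) a (suc j) y = potential i a j y

  potential-self : ∀ i a → potential i a i a ≡ 0
  potential-self zero    a = cycleDist-self n a
  potential-self (suc i) a = potential-self i a

  potential-+ : ∀ i d a b → potential i a (i + d) b ≡ copyDistBound d a b
  potential-+ zero    d a b = refl
  potential-+ (suc i) d a b = potential-+ i d a b

  near-potential-within : ∀ i a j {y z} →
    Near (cycleDist n a y) (cycleDist n a z) → Near (cycleDist n 0 y) (cycleDist n 0 z) →
    Near (potential i a j y) (potential i a j z)
  near-potential-within zero    a zero    near-a near-0 = near-a
  near-potential-within zero    a (suc k) near-a near-0 =
    near-+ˡ 1 (near-+ʳ (k * suc (cycleDist n 0 ℓ)) (near-+ˡ (cycleDist n a ℓ) near-0))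
  near-potential-within (suc i) a zero    near-a near-0 = near-refl _
  near-potential-within (suc i) a (suc j) near-a near-0 = near-potential-within i a j near-a near-0

  near-potential-bridge : ∀ i a j → Near (potential i a j ℓ) (potential i a (suc j) 0)
  near-potential-bridge zero a zero =
    subst (Near _) (cong suc (sym (trans (+-identityʳ _) (+-identityʳ _))))
          (near-suc (cycleDist n a ℓ))
  near-potential-bridge zero a (suc k) =
    subst (Near _) (cong suc (sym (bridge _ _ _))) (near-suc _)
    where
    bridge : ∀ x y z → x + 0 + (suc y + z) ≡ suc (x + y + z)
    bridge x y z = begin
      x + 0 + (suc y + z) ≡⟨ cong (_+ (suc y + z)) (+-identityʳ x) ⟩
      x + suc (y + z)     ≡⟨ +-suc x (y + z) ⟩
      suc (x + (y + z))   ≡⟨ cong suc (+-assoc x y z) ⟨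
      suc (x + y + z)     ∎
      where open ≡-Reasoning
  near-potential-bridge (suc zero)    a zero    = near-sym (near-suc _)
  near-potential-bridge (suc (suc i)) a zero    = near-refl _
  near-potential-bridge (suc i)       a (suc j) = near-potential-bridge i a j

  record Separated (c : ℕ → Fin n → ℕ) : Set where
    field
      within-copy   : ∀ i {a b} → a ≢ b → c i a ≡ c i b →
                      suc (c i a) ≤ cycleDist n (toℕ a) (toℕ b)
      across-copies : ∀ i k a b → c i a ≡ c (i + suc k) b →
                      suc (c i a) ≤ copyDistBound (suc k) (toℕ a) (toℕ b)

module PathAlignedCycle (m ℓ n : ℕ) {{_ : NonZero n}} (ℓ<n : ℓ < n) where

  G : Graph
  G = PathAligned m ℓ (Cycle n) (λ j → toℕ j mod n)

  adj-sym : Symmetric (Adj G)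
  adj-sym {_ , _} {_ , _} (inj₁ (i≡j , inj₁ e))  = inj₁ (sym i≡j , inj₂ e)
  adj-sym {_ , _} {_ , _} (inj₁ (i≡j , inj₂ e))  = inj₁ (sym i≡j , inj₁ e)
  adj-sym {_ , _} {_ , _} (inj₂ (inj₁ bridge)) = inj₂ (inj₂ bridge)
  adj-sym {_ , _} {_ , _} (inj₂ (inj₂ bridge)) = inj₂ (inj₁ bridge)

  toℕ-exit : toℕ (toℕ (fromℕ ℓ) mod n) ≡ ℓ
  toℕ-exit = trans (toℕ-fromℕ< _) (trans (cong (_% n) (toℕ-fromℕ ℓ)) (m<n⇒m%n≡m ℓ<n))

  toℕ-entry : toℕ (toℕ (fzero {ℓ}) mod n) ≡ 0
  toℕ-entry = trans (toℕ-fromℕ< _) (m<n⇒m%n≡m (>-nonZero⁻¹ n))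

  near-cycleDist-adj : ∀ {y z} → Adj (Cycle n) y z → ∀ {a} → a < n →
                       Near (cycleDist n a (toℕ y)) (cycleDist n a (toℕ z))
  near-cycleDist-adj {y} {z} (inj₁ z≡1+y) {a} a<n =
    subst (Near _ ∘ cycleDist n a) (sym z≡1+y) (cycleDist-step a<n (toℕ<n y))
  near-cycleDist-adj {y} {z} (inj₂ y≡1+z) {a} a<n =
    near-sym (subst (Near _ ∘ cycleDist n a) (sym y≡1+z) (cycleDist-step a<n (toℕ<n z)))

  potentialFrom : V G → V G → ℕ
  potentialFrom (i , a) (j , y) = potential n ℓ (toℕ i) (toℕ a) (toℕ j) (toℕ y)

  potentialFrom-lipschitz : ∀ u → Lipschitz G (potentialFrom u)
  potentialFrom-lipschitz (i , a) {j , _} {_ , _} (inj₁ (refl , y~z)) =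
    proj₂ (near-potential-within n ℓ (toℕ i) (toℕ a) (toℕ j)
            (near-cycleDist-adj y~z (toℕ<n a)) (near-cycleDist-adj y~z (>-nonZero⁻¹ n)))
  potentialFrom-lipschitz (i , a) {j , _} {_ , _} (inj₂ (inj₁ (k≡1+j , refl , refl)))
    rewrite k≡1+j | toℕ-exit | toℕ-entry =
    proj₂ (near-potential-bridge n ℓ (toℕ i) (toℕ a) (toℕ j))
  potentialFrom-lipschitz (i , a) {_ , _} {k , _} (inj₂ (inj₂ (j≡1+k , refl , refl)))
    rewrite j≡1+k | toℕ-exit | toℕ-entry =
    proj₁ (near-potential-bridge n ℓ (toℕ i) (toℕ a) (toℕ k))

  DistGe-copyDistBound : ∀ {i j d} (a b : Fin n) → toℕ i + d ≡ toℕ j →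
                         DistGe G (i , a) (j , b) (copyDistBound n ℓ d (toℕ a) (toℕ b))
  DistGe-copyDistBound {i} {j} {d} a b i+d≡j = subst (DistGe G (i , a) (j , b)) potential≡bound
    (lipschitz⇒DistGe G (potentialFrom-lipschitz (i , a))
                        (potential-self n ℓ (toℕ i) (toℕ a)) (j , b))
    where
    potential≡bound : potentialFrom (i , a) (j , b) ≡ copyDistBound n ℓ d (toℕ a) (toℕ b)
    potential≡bound = trans (cong (λ j → potential n ℓ (toℕ i) (toℕ a) j (toℕ b)) (sym i+d≡j))
                            (potential-+ n ℓ (toℕ i) d (toℕ a) (toℕ b))

  colouring : (ℕ → Fin n → ℕ) → V G → ℕ
  colouring c (i , a) = c (toℕ i) a

  separated⇒packing : ∀ {k c} → (∀ i a → 1 ≤ c i a × c i a ≤ k) → Separated n ℓ c →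
                      IsPackingColoring G k (colouring c)
  separated⇒packing {c = c} range sep = (λ (i , a) → range (toℕ i) a) , packing
    where
    open Separated sep

    forward : ∀ {i j a b} → toℕ i ≤ toℕ j → (i , a) ≢ (j , b) → c (toℕ i) a ≡ c (toℕ j) b →
              DistGe G (i , a) (j , b) (suc (c (toℕ i) a))
    forward {i} {j} {a} {b} i≤j u≢v same with m≤n⇒∃[o]m+o≡n i≤j
    ... | d , i+d≡j = λ k w → ≤-trans (separation d i+d≡j) (DistGe-copyDistBound a b i+d≡j k w)
      where
      separation : ∀ d → toℕ i + d ≡ toℕ j →
                   suc (c (toℕ i) a) ≤ copyDistBound n ℓ d (toℕ a) (toℕ b)
      separation zero    i+0≡j = within-copy (toℕ i) (u≢v ∘ cong₂ _,_ i≡j)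
                                   (trans same (cong (λ x → c (toℕ x) b) (sym i≡j)))
        where
        i≡j : i ≡ j
        i≡j = toℕ-injective (trans (sym (+-identityʳ (toℕ i))) i+0≡j)
      separation (suc d) i+d≡j =
        across-copies (toℕ i) d a b (trans same (cong (λ x → c x b) (sym i+d≡j)))

    packing : ∀ u v → u ≢ v → colouring c u ≡ colouring c v → DistGe G u v (suc (colouring c u))
    packing (i , a) (j , b) u≢v same with ≤-total (toℕ i) (toℕ j)
    ... | inj₁ i≤j = forward i≤j u≢v same
    ... | inj₂ j≤i = subst (DistGe G _ _ ∘ suc) (sym same)
                       (DistGe-sym adj-sym (forward j≤i (u≢v ∘ sym) (sym same)))

period : ℕ → ℕ
period 0 = 1
period 1 = 3
period 2 = 1
period 3 = 2
period (suc (suc (suc (suc x)))) = period x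

period-cases : ∀ x → period x ≡ 1 ⊎ period x ≡ 2 ⊎ period x ≡ 3
period-cases 0 = inj₁ refl
period-cases 1 = inj₂ (inj₂ refl)
period-cases 2 = inj₁ refl
period-cases 3 = inj₂ (inj₁ refl)
period-cases (suc (suc (suc (suc x)))) = period-cases x

1≤period : ∀ x → 1 ≤ period x
1≤period x with period-cases x
... | inj₁ p         rewrite p = ≤-refl
... | inj₂ (inj₁ p)  rewrite p = s≤s z≤n
... | inj₂ (inj₂ p)  rewrite p = s≤s z≤n

period≤3 : ∀ x → period x ≤ 3
period≤3 x with period-cases x
... | inj₁ p         rewrite p = s≤s z≤n
... | inj₂ (inj₁ p)  rewrite p = s≤s (s≤s z≤n)
... | inj₂ (inj₂ p)  rewrite p = ≤-refl

period≢4 : ∀ x → period x ≢ 4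
period≢4 x p = n≮n 3 (subst (_≤ 3) p (period≤3 x))

period-gap : ∀ a k → period a ≡ period (suc a + k) → period a ≤ k
period-gap 0 0 ()
period-gap 0 (suc k) _ = s≤s z≤n
period-gap 1 0 ()
period-gap 1 1 ()
period-gap 1 2 ()
period-gap 1 (suc (suc (suc k))) _ = s≤s (s≤s (s≤s z≤n))
period-gap 2 0 ()
period-gap 2 (suc k) _ = s≤s z≤n
period-gap 3 0 ()
period-gap 3 1 ()
period-gap 3 (suc (suc k)) _ = s≤s (s≤s z≤n)
period-gap (suc (suc (suc (suc a)))) k p = period-gap a k p

period≡1⇒≢3 : ∀ {x} → period x ≡ 1 → x ≢ 3
period≡1⇒≢3 () refl

period≡2⇒3≤ : ∀ {x} → period x ≡ 2 → 3 ≤ x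
period≡2⇒3≤ {3} _ = ≤-refl
period≡2⇒3≤ {suc (suc (suc (suc x)))} _ = s≤s (s≤s (s≤s z≤n))

period≡3⇒1≤ : ∀ {x} → period x ≡ 3 → 1 ≤ x
period≡3⇒1≤ {suc x} _ = s≤s z≤n

period≡3⇒1⊎5≤ : ∀ {x} → period x ≡ 3 → x ≡ 1 ⊎ 5 ≤ x
period≡3⇒1⊎5≤ {1} _ = inj₁ refl
period≡3⇒1⊎5≤ {suc (suc (suc (suc (suc x))))} _ = inj₂ (s≤s (s≤s (s≤s (s≤s (s≤s z≤n)))))

period≡3⇒3+≤4* : ∀ s {x} → period x ≡ 3 → x < 4 * s → 3 + x ≤ 4 * s
period≡3⇒3+≤4* (suc s) {x} p x<4s =
  subst (3 + x ≤_) (sym (*-suc 4 s)) (below x p (subst (x <_) (*-suc 4 s) x<4s))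
  where
  below : ∀ x → period x ≡ 3 → x < 4 + 4 * s → 3 + x ≤ 4 + 4 * s
  below 1 _ _ = s≤s (s≤s (s≤s (s≤s z≤n)))
  below (suc (suc (suc (suc x)))) p (s≤s (s≤s (s≤s (s≤s x<4s)))) =
    s≤s (s≤s (s≤s (s≤s (period≡3⇒3+≤4* s p x<4s))))

period-wrap : ∀ s {a b} → period a ≡ period b → b < 4 * s → period a + b ≤ a + 4 * s
period-wrap s {a} {b} same b<4s with period-cases a
... | inj₁ p rewrite p = ≤-trans b<4s (m≤n+m (4 * s) a)
... | inj₂ (inj₁ p) rewrite p = +-mono-≤ (≤-trans (s≤s z≤n) (period≡2⇒3≤ {a} p)) b<4s
... | inj₂ (inj₂ p) rewrite p = ≤-trans (period≡3⇒3+≤4* s (sym same) b<4s) (m≤n+m (4 * s) a)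

module Stripes (s : ℕ) (2≤s : 2 ≤ s) where

  n : ℕ
  n = suc (4 * s)

  stripes : ℕ → ℕ
  stripes x with x ≟ 4 * s
  ... | yes _ = 4
  ... | no  _ = period x

  stripes-top : stripes (4 * s) ≡ 4
  stripes-top with 4 * s ≟ 4 * s
  ... | yes _    = refl
  ... | no  4s≢4s = ⊥-elim (4s≢4s refl)

  stripes-below : ∀ {x} → x < 4 * s → stripes x ≡ period x
  stripes-below {x} x<4s with x ≟ 4 * s
  ... | yes x≡4s = ⊥-elim (<-irrefl x≡4s x<4s)
  ... | no  _    = refl

  stripes-range : ∀ x → 1 ≤ stripes x × stripes x ≤ 5
  stripes-range x with x ≟ 4 * s
  ... | yes _ = s≤s z≤n , s≤s (s≤s (s≤s (s≤s z≤n)))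
  ... | no  _ = 1≤period x , m≤n⇒m≤1+n (m≤n⇒m≤1+n (period≤3 x))

  position-cases : ∀ {x} → x < n → x < 4 * s ⊎ x ≡ 4 * s
  position-cases x<n = m≤n⇒m<n∨m≡n (≤-pred x<n)

  period-within : ∀ {x y} → x < y → y < 4 * s → period x ≡ period y →
                  suc (period x) ≤ cycleDist n x y
  period-within {x} {y} x<y y<4s same with m≤n⇒∃[o]m+o≡n x<y
  ... | k , refl = cycleDist-≥ n gap wrap
    where
    gap : suc (period x) + x ≤ suc x + k
    gap = subst (suc (period x) + x ≤_) (cong suc (+-comm k x))
                (s≤s (+-monoˡ-≤ x (period-gap x k same)))
    wrap : suc (period x) + (suc x + k) ≤ x + n
    wrap = subst (suc (period x) + (suc x + k) ≤_) (sym (+-suc x (4 * s)))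
                 (s≤s (period-wrap s {x} same y<4s))

  stripes-within : ∀ {x y} → x < y → y < n → stripes x ≡ stripes y →
                   suc (stripes x) ≤ cycleDist n x y
  stripes-within {x} {y} x<y y<n same with position-cases y<n
  ... | inj₁ y<4s rewrite stripes-below (<-trans x<y y<4s) | stripes-below y<4s =
    period-within x<y y<4s same
  ... | inj₂ refl rewrite stripes-below x<y | stripes-top = ⊥-elim (period≢4 x same)

  8≤4s : 8 ≤ 4 * s
  8≤4s = *-monoʳ-≤ 4 2≤s

  3<n : 3 < n
  3<n = s≤s (≤-trans (m≤n+m 3 5) 8≤4s)

  period-across : ∀ {x y} → x < 4 * s → y < 4 * s → period x ≡ period y →
                  period x ≤ cycleDist n x 3 + cycleDist n 0 y
  period-across {x} {y} x<4s y<4s same with period-cases x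
  ... | inj₁ p rewrite p =
    ≤-trans (cycleDist-pos (period≡1⇒≢3 p) (m<n⇒m<1+n x<4s) 3<n)
            (m≤m+n _ _)
  ... | inj₂ (inj₁ p) rewrite p =
    ≤-trans (cycleDist-≥ n (≤-trans (n≤1+n 2) (period≡2⇒3≤ (sym same))) (s≤s y<4s)) (m≤n+m _ _)
  ... | inj₂ (inj₂ p) rewrite p =
    +-mono-≤ x-far-from-3 (cycleDist-≥ n (period≡3⇒1≤ (sym same)) (s≤s (<⇒≤ y<4s)))
    where
    x-far-from-3 : 2 ≤ cycleDist n x 3
    x-far-from-3 with period≡3⇒1⊎5≤ {x} p
    ... | inj₁ x≡1 = subst (λ x → 2 ≤ cycleDist n x 3) (sym x≡1)
                       (cycleDist-≥ n ≤-refl (s≤s (s≤s (≤-trans (m≤n+m 3 5) 8≤4s))))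
    ... | inj₂ 5≤x = subst (2 ≤_) (cycleDist-comm n 3 x)
                       (cycleDist-≥ n 5≤x (s≤s (s≤s (≤-trans (<⇒≤ x<4s) (m≤n+m (4 * s) 2)))))

  cycleDist-4s-3 : 4 ≤ cycleDist n (4 * s) 3
  cycleDist-4s-3 =
    subst (4 ≤_) (cycleDist-comm n 3 (4 * s)) (cycleDist-≥ n (≤-trans (n≤1+n 7) 8≤4s) ≤-refl)

  stripes-across : ∀ {x y} → x < n → y < n → stripes x ≡ stripes y →
                   stripes x ≤ cycleDist n x 3 + cycleDist n 0 y
  stripes-across {x} {y} x<n y<n same with position-cases x<n | position-cases y<n
  ... | inj₁ x<4s | inj₁ y<4s rewrite stripes-below x<4s | stripes-below y<4s =
    period-across x<4s y<4s same
  ... | inj₁ x<4s | inj₂ refl rewrite stripes-below x<4s | stripes-top = ⊥-elim (period≢4 x same)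
  ... | inj₂ refl | inj₁ y<4s rewrite stripes-top | stripes-below y<4s = ⊥-elim (period≢4 y (sym same))
  ... | inj₂ refl | inj₂ refl rewrite stripes-top = ≤-trans cycleDist-4s-3 (m≤m+n _ _)

  stripes-separated : Separated n 3 (λ _ a → stripes (toℕ a))
  stripes-separated = record { within-copy = within ; across-copies = across }
    where
    within : ∀ i {a b : Fin n} → a ≢ b → stripes (toℕ a) ≡ stripes (toℕ b) →
             suc (stripes (toℕ a)) ≤ cycleDist n (toℕ a) (toℕ b)
    within _ {a} {b} a≢b same with <-cmp (toℕ a) (toℕ b)
    ... | tri< a<b _ _ = stripes-within a<b (toℕ<n b) same
    ... | tri≈ _ a≡b _ = ⊥-elim (a≢b (toℕ-injective a≡b))
    ... | tri> _ _ b<a = subst₂ (λ c d → suc c ≤ d) (sym same) (cycleDist-comm n (toℕ b) (toℕ a))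
                           (stripes-within b<a (toℕ<n a) (sym same))
    across : ∀ i k (a b : Fin n) → stripes (toℕ a) ≡ stripes (toℕ b) →
             suc (stripes (toℕ a)) ≤ copyDistBound n 3 (suc k) (toℕ a) (toℕ b)
    across _ _ a b same = s≤s (≤-trans (stripes-across (toℕ<n a) (toℕ<n b) same) (m≤m+n _ _))

palette : Fin 2 → Fin 5 → ℕ
palette p = lookup (lookup table p)
  where
  table : Vec (Vec ℕ 5) 2
  table = (1 ∷ 2 ∷ 3 ∷ 1 ∷ 4 ∷ []) ∷ (2 ∷ 1 ∷ 3 ∷ 5 ∷ 1 ∷ []) ∷ []

parity : ℕ → Fin 2
parity zero          = fzero
parity (suc zero)    = fsuc fzero
parity (suc (suc i)) = parity i

parity-alternates : ∀ i → parity i ≢ parity (i + 1)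
parity-alternates zero          ()
parity-alternates (suc zero)    ()
parity-alternates (suc (suc i)) = parity-alternates i

palette-range : ∀ p a → 1 ≤ palette p a × palette p a ≤ 5
palette-range = from-yes (all? λ p → all? λ a → (1 ≤? palette p a) ×-dec (palette p a ≤? 5))

palette-within : ∀ p a b → a ≢ b → palette p a ≡ palette p b →
                 suc (palette p a) ≤ cycleDist 5 (toℕ a) (toℕ b)
palette-within = from-yes (all? λ p → all? λ a → all? λ b →
  ¬? (a ≟ᶠ b) →-dec (palette p a ≟ palette p b) →-dec
  (suc (palette p a) ≤? cycleDist 5 (toℕ a) (toℕ b)))

palette-next : ∀ p q → p ≢ q → ∀ a b → palette p a ≡ palette q b →
               suc (palette p a) ≤ copyDistBound 5 3 1 (toℕ a) (toℕ b)
palette-next = from-yes (all? λ p → all? λ q → ¬? (p ≟ᶠ q) →-dec all? λ a → all? λ b →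
  (palette p a ≟ palette q b) →-dec (suc (palette p a) ≤? copyDistBound 5 3 1 (toℕ a) (toℕ b)))

palette-far : ∀ p q a b → palette p a ≡ palette q b →
              suc (palette p a) ≤ copyDistBound 5 3 2 (toℕ a) (toℕ b)
palette-far = from-yes (all? λ p → all? λ q → all? λ a → all? λ b →
  (palette p a ≟ palette q b) →-dec (suc (palette p a) ≤? copyDistBound 5 3 2 (toℕ a) (toℕ b)))

alternating : ℕ → Fin 5 → ℕ
alternating i = palette (parity i)

alternating-separated : Separated 5 3 alternating
alternating-separated = record { within-copy = within ; across-copies = across }
  where
  within : ∀ i {a b} → a ≢ b → alternating i a ≡ alternating i b →
           suc (alternating i a) ≤ cycleDist 5 (toℕ a) (toℕ b)
  within i = palette-within (parity i) _ _
  across : ∀ i k a b → alternating i a ≡ alternating (i + suc k) b →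
           suc (alternating i a) ≤ copyDistBound 5 3 (suc k) (toℕ a) (toℕ b)
  across i zero    a b same = palette-next (parity i) (parity (i + 1)) (parity-alternates i) a b same
  across i (suc k) a b same = ≤-trans (palette-far (parity i) (parity (i + suc (suc k))) a b same)
                                      (copyDistBound-mono 5 3 {1} {suc k} (toℕ a) (toℕ b) (s≤s z≤n))

theorem14 : ∀ s t → 1 ≤ s → 1 ≤ t → PackingChromaticNumber≤ (P◇C t s) 5
theorem14 zero          t () _
theorem14 (suc zero)    t _ _ =
  5 , ≤-refl , _ , separated⇒packing (λ i → palette-range (parity i)) alternating-separated
  where open PathAlignedCycle (4 * t) 3 5 (s≤s (s≤s (s≤s (s≤s z≤n))))
theorem14 (suc (suc s)) t _ _ =
  5 , ≤-refl , _ , separated⇒packing (λ _ a → stripes-range (toℕ a)) stripes-separated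
  where
  open Stripes (suc (suc s)) (s≤s (s≤s z≤n))
  open PathAlignedCycle (4 * t) 3 n 3<n
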